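{- Fix real numbers $R_1,R_2\ge1$. For $N>0$ let $\mathcal{R}_{\mathbb{Z}^3}(N,R_1,R_2)=\{(a,b,c)\in\mathbb{Z}_{\ge1}^3 : ab^{2/3}c<N,\ a/c\in[1,R_1],\ b\in[1,R_2]\}$. For a prime $\ell$, let $\mathcal{C}'_\ell(N,R_1,R_2)$ be the set of triples in $\mathcal{R}_{\mathbb{Z}^3}(N,R_1,R_2)$ that are not $\ell$-carefree. Then there is a constant $K>0$ depending only on $R_1,R_2$ (not on $N$ or $\ell$) such that for all primes $\ell$ and all $N\ge1$, $$\frac{\#\mathcal{C}'_\ell(N,R_1,R_2)}{N}\le K\left(\frac{1}{\ell^{4/3}}+\frac{1}{\sqrt N}\right).$$
   Context: A triple $(a,b,c)\in\mathbb{Z}_{>0}^3$ is $\ell$-carefree if $\ell^2\nmid ab$, $\ell^2\nmid bc$ and $\ell^2\nmid ca$.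
   Formalization: The parameters $R_1,R_2$ and $N$ range over the rationals instead of the reals. -}

module Defs where

open import Data.Nat as ℕ using (ℕ)
open import Data.Nat.Divisibility using (_∣_)
open import Data.Integer using (+_)
open import Data.Rational using (ℚ; _/_; _*_; _<_; _≤_)
open import Data.Product using (_×_; _,_)
open import Data.Sum using (_⊎_)
open import Relation.Nullary using (¬_)

ι : ℕ → ℚ
ι n = + n / 1

Carefree : ℕ → ℕ → ℕ → ℕ → Set
Carefree ℓ a b c =
  ¬ (ℓ ℕ.* ℓ ∣ a ℕ.* b) × ¬ (ℓ ℕ.* ℓ ∣ b ℕ.* c) × ¬ (ℓ ℕ.* ℓ ∣ c ℕ.* a)

-- membership in R_{Z^3}(N,R1,R2):
--   a,b,c ≥ 1,  a b^{2/3} c < N  (equivalently (ac)^3 b^2 < N^3, all quantities positive),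
--   1 ≤ a/c ≤ R1  (equivalently c ≤ a ≤ R1·c since c ≥ 1),
--   1 ≤ b ≤ R2
InRegion : ℚ → ℚ → ℚ → ℕ × ℕ × ℕ → Set
InRegion N R₁ R₂ (a , b , c) =
  1 ℕ.≤ a × 1 ℕ.≤ b × 1 ℕ.≤ c
  × ι ((a ℕ.* c) ℕ.* (a ℕ.* c) ℕ.* (a ℕ.* c) ℕ.* (b ℕ.* b)) < N * N * N
  × c ℕ.≤ a × ι a ≤ R₁ * ι c
  × ι b ≤ R₂

InC' : ℕ → ℚ → ℚ → ℚ → ℕ × ℕ × ℕ → Set
InC' ℓ N R₁ R₂ t@(a , b , c) =
  InRegion N R₁ R₂ t × ¬ Carefree ℓ a b c

-- Since b ≤ R₂, the factor b^{2/3} can be dropped: it suffices to count triples with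
-- c ≤ a ≤ r·c, 1 ≤ b ≤ r and a·c ≤ M = ⌊N⌋, where r is an integer above R₁ and R₂.
-- For ℓ ≤ r the trivial bound 3r²M is already at most 3r⁴M/ℓ². For ℓ > r ≥ b, ℓ cannot
-- divide b, so a triple that is not ℓ-carefree has ℓ | a and ℓ | c, or ℓ² | a, or ℓ² | c.
-- In each case (a, c) is determined by two numbers X, Y with Y ≤ s·X (for instance
-- X = c/ℓ, Y = a/ℓ, s = r in the first case) and (s·X² + Y + 1)·ℓ² ≤ 3r·ac ≤ 3r·M.
-- The key s·X² + Y is injective, because consecutive values of s·x² are more than s·x
-- apart, so together with the r choices of b each case has at most 3r²M/ℓ² triples.

module Submission where

module Counting where

  open import Data.Nat using (ℕ; suc; _+_; _*_; _≤_; _<_; NonZero)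
  open import Data.Nat.Properties
  open import Data.Nat.DivMod using (_/_; m/n*n≤m; m*n/n≡m; /-monoˡ-≤)
  open import Algebra.Properties.CommutativeSemigroup *-commutativeSemigroup using (x∙yz≈y∙xz)
  open import Data.Fin using (Fin; zero; suc; fromℕ<)
  open import Data.Fin.Properties using (injective⇒≤; fromℕ<-injective)
  open import Data.List using (List; []; _∷_; length; lookup; filter)
  open import Data.List.Membership.Propositional.Properties using (∈-lookup)
  open import Data.List.Relation.Unary.All as All using (All)
  import Data.List.Relation.Unary.All.Properties as All
  open import Data.List.Relation.Unary.AllPairs using (_∷_)
  open import Data.List.Relation.Unary.Unique.Propositional using (Unique)
  import Data.List.Relation.Unary.Unique.Propositional.Properties as Unique
  open import Data.Product using (_,_)
  open import Data.Empty using (⊥-elim)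
  open import Function using (_∘_)
  open import Level using (0ℓ)
  open import Relation.Nullary using (yes; no; ¬?)
  open import Relation.Unary using (Pred; Decidable; _∩_; ∁; _⊆_)
  open import Relation.Binary.PropositionalEquality

  module _ {A : Set} where

    lookup-injective : ∀ {xs : List A} → Unique xs → ∀ {i j} → lookup xs i ≡ lookup xs j → i ≡ j
    lookup-injective (_ ∷ _) {zero} {zero} _ = refl
    lookup-injective (x∉xs ∷ _) {zero} {suc j} eq = ⊥-elim (All.lookup x∉xs (∈-lookup j) eq)
    lookup-injective (x∉xs ∷ _) {suc i} {zero} eq = ⊥-elim (All.lookup x∉xs (∈-lookup i) (sym eq))
    lookup-injective (_ ∷ u) {suc i} {suc j} eq = cong suc (lookup-injective u eq)

    length-filter-∁ : ∀ {P : Pred A 0ℓ} (P? : Decidable P) xs →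
      length xs ≡ length (filter P? xs) + length (filter (¬? ∘ P?) xs)
    length-filter-∁ P? [] = refl
    length-filter-∁ P? (x ∷ xs) with P? x
    ... | yes _ = cong suc (length-filter-∁ P? xs)
    ... | no _ = trans (cong suc (length-filter-∁ P? xs)) (sym (+-suc _ _))

    -- W · #P ≤ B, finite subsets of P being given as duplicate-free lists.
    infix 4 _·#_≤_
    _·#_≤_ : ℕ → Pred A 0ℓ → ℕ → Set
    W ·# P ≤ B = ∀ {xs} → Unique xs → All P xs → length xs * W ≤ B

    module _ {P : Pred A 0ℓ} (key : ∀ {x} → P x → ℕ)
             (key-injective : ∀ {x y} (p : P x) (q : P y) → key p ≡ key q → x ≡ y) where

      length≤ : ∀ {xs m} → Unique xs → All P xs → (∀ {x} (p : P x) → key p < m) → length xs ≤ m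
      length≤ {xs} u ps bounded = injective⇒≤ code-injective
        where
        at : (i : Fin (length xs)) → P (lookup xs i)
        at i = All.lookup ps (∈-lookup i)
        code : Fin (length xs) → Fin _
        code i = fromℕ< (bounded (at i))
        code-injective : ∀ {i j} → code i ≡ code j → i ≡ j
        code-injective {i} {j} eq =
          lookup-injective u (key-injective (at i) (at j) (fromℕ<-injective _ _ _ _ eq))

      ·#-by-key : ∀ {W B} .{{_ : NonZero W}} → (∀ {x} (p : P x) → suc (key p) * W ≤ B) → W ·# P ≤ B
      ·#-by-key {W} {B} bounded u ps =
        ≤-trans (*-monoˡ-≤ W (length≤ u ps key<B/W)) (m/n*n≤m B W)
        where
        key<B/W : ∀ {x} (p : P x) → key p < B / W
        key<B/W p = ≤-trans (≤-reflexive (sym (m*n/n≡m (suc (key p)) W))) (/-monoˡ-≤ W (bounded p))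

    ·#-⊆ : ∀ {P Q : Pred A 0ℓ} {W B} → P ⊆ Q → W ·# Q ≤ B → W ·# P ≤ B
    ·#-⊆ P⊆Q count u ps = count u (All.map P⊆Q ps)

    ·#-split : ∀ {P Q : Pred A 0ℓ} {W B₁ B₂} → Decidable Q →
               W ·# (P ∩ Q) ≤ B₁ → W ·# (P ∩ ∁ Q) ≤ B₂ → W ·# P ≤ B₁ + B₂
    ·#-split {P} {Q} {W} {B₁} {B₂} Q? count₁ count₂ {xs} u ps = begin
      length xs * W                  ≡⟨ cong (_* W) (length-filter-∁ Q? xs) ⟩
      (length ys + length zs) * W    ≡⟨ *-distribʳ-+ W (length ys) (length zs) ⟩
      length ys * W + length zs * W  ≤⟨ +-mono-≤ (count₁ (Unique.filter⁺ Q? u) (on Q? ps))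
                                                 (count₂ (Unique.filter⁺ (¬? ∘ Q?) u) (on (¬? ∘ Q?) ps)) ⟩
      B₁ + B₂                        ∎
      where
      open ≤-Reasoning
      ys = filter Q? xs
      zs = filter (¬? ∘ Q?) xs
      on : ∀ {R : Pred A 0ℓ} (R? : Decidable R) → All P xs → All (P ∩ R) (filter R? xs)
      on R? ps = All.zip (All.filter⁺ R? ps , All.all-filter R? xs)

    ·#-weaken : ∀ {P : Pred A 0ℓ} {W W' B} k → W' ≤ k * W → W ·# P ≤ B → W' ·# P ≤ k * B
    ·#-weaken {W = W} {W'} {B} k W'≤kW count {xs} u ps = begin
      length xs * W'        ≤⟨ *-monoʳ-≤ (length xs) W'≤kW ⟩
      length xs * (k * W)   ≡⟨ x∙yz≈y∙xz (length xs) k W ⟩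
      k * (length xs * W)   ≤⟨ *-monoʳ-≤ k (count u ps) ⟩
      k * B                 ∎
      where open ≤-Reasoning

    ·#-≤ : ∀ {P : Pred A 0ℓ} {W B B'} → B ≤ B' → W ·# P ≤ B → W ·# P ≤ B'
    ·#-≤ B≤B' count u ps = ≤-trans (count u ps) B≤B'


module Charts where

  open import Data.Nat using (ℕ; suc; pred; _+_; _*_; _≤_; _<_; NonZero; >-nonZero; >-nonZero⁻¹)
  open import Data.Nat.Properties
  open import Data.Nat.Divisibility using (_∣_; divides-refl; quotient)
  open import Data.Nat.Tactic.RingSolver using (solve-∀; solve)
  open import Data.List using ([]; _∷_)
  open import Data.Product using (_×_; _,_; proj₂)
  open import Data.Unit using (⊤)
  open import Data.Empty using (⊥-elim)
  open import Level using (0ℓ)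
  open import Relation.Binary using (tri<; tri≈; tri>)
  open import Relation.Unary using (Pred; _∩_)
  open import Relation.Binary.PropositionalEquality
  open Counting

  module _ (g : ℕ → ℕ) (g-mono : ∀ {m n} → m ≤ n → g m ≤ g n) where

    offset-injective : ∀ {x x' y y'} → g x + y < g (suc x) → g x' + y' < g (suc x') →
                       g x + y ≡ g x' + y' → x ≡ x' × y ≡ y'
    offset-injective {x} {x'} {y} {y'} lt lt' eq with <-cmp x x'
    ... | tri< x<x' _ _ = ⊥-elim (<-irrefl eq (<-≤-trans lt (≤-trans (g-mono x<x') (m≤m+n _ y'))))
    ... | tri> _ _ x>x' = ⊥-elim (<-irrefl (sym eq) (<-≤-trans lt' (≤-trans (g-mono x>x') (m≤m+n _ y))))
    ... | tri≈ _ refl _ = refl , +-cancelˡ-≡ (g x) y y' eq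

  square-key : ℕ → ℕ → ℕ → ℕ
  square-key s x y = s * (x * x) + y

  square-key-injective : ∀ {s x x' y y'} → 1 ≤ s → y ≤ s * x → y' ≤ s * x' →
                         square-key s x y ≡ square-key s x' y' → x ≡ x' × y ≡ y'
  square-key-injective {s} 1≤s y≤sx y'≤sx' = offset-injective (λ x → s * (x * x))
    (λ x≤x' → *-monoʳ-≤ s (*-mono-≤ x≤x' x≤x')) (below y≤sx) (below y'≤sx')
    where
    below : ∀ {x y} → y ≤ s * x → s * (x * x) + y < s * (suc x * suc x)
    below {x} {y} y≤sx = begin-strict
      s * (x * x) + y        ≤⟨ +-monoʳ-≤ (s * (x * x)) y≤sx ⟩
      s * (x * x) + s * x    ≡⟨ solve (s ∷ x ∷ []) ⟩
      s * (x * suc x)        <⟨ *-monoʳ-< s (*-monoˡ-< (suc x) (n<1+n x)) ⟩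
      s * (suc x * suc x)    ∎
      where
      open ≤-Reasoning
      instance _ = >-nonZero 1≤s

  digit-key< : ∀ r k {d} → 1 ≤ d → d ≤ r → r * k + pred d < r * suc k
  digit-key< r k {suc d} _ d<r = begin-strict
    r * k + d   <⟨ +-monoʳ-< (r * k) d<r ⟩
    r * k + r   ≡⟨ +-comm (r * k) r ⟩
    r + r * k   ≡⟨ *-suc r k ⟨
    r * suc k   ∎
    where open ≤-Reasoning

  Triple : Set
  Triple = ℕ × ℕ × ℕ

  record Cone (r a c : ℕ) : Set where
    field
      1≤c  : 1 ≤ c
      c≤a  : c ≤ a
      a≤rc : a ≤ r * c

    1≤a : 1 ≤ a
    1≤a = ≤-trans 1≤c c≤a

  record InBox (r M a b c : ℕ) : Set where
    field
      cone : Cone r a c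
      1≤b  : 1 ≤ b
      b≤r  : b ≤ r
      ac≤M : a * c ≤ M

  Box : ℕ → ℕ → Pred Triple 0ℓ
  Box r M (a , b , c) = InBox r M a b c

  record Chart (r W : ℕ) (P : ℕ → ℕ → Set) : Set where
    field
      s          : ℕ
      1≤s        : 1 ≤ s
      X Y        : ∀ {a c} → P a c → ℕ
      injective  : ∀ {a c a' c'} (p : P a c) (p' : P a' c') →
                   X p ≡ X p' → Y p ≡ Y p' → a ≡ a' × c ≡ c'
      Y≤sX       : ∀ {a c} → Cone r a c → (p : P a c) → Y p ≤ s * X p
      sX²W≤rac   : ∀ {a c} → Cone r a c → (p : P a c) → s * (X p * X p) * W ≤ r * (a * c)
      YW≤ac      : ∀ {a c} → Cone r a c → (p : P a c) → Y p * W ≤ a * c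
      W≤ac       : ∀ {a c} → Cone r a c → (p : P a c) → W ≤ a * c

    key : ∀ {a c} → P a c → ℕ
    key p = square-key s (X p) (Y p)

    suc-key*W≤3rac : ∀ {a c} → 1 ≤ r → Cone r a c → (p : P a c) →
                     suc (key p) * W ≤ 3 * r * (a * c)
    suc-key*W≤3rac {a} {c} 1≤r cone p = begin
      suc (key p) * W                          ≡⟨ expand s (X p) (Y p) W ⟩
      W + s * (X p * X p) * W + Y p * W        ≤⟨ +-mono-≤ (+-mono-≤ (≤-trans (W≤ac cone p) ac≤rac)
                                                                     (sX²W≤rac cone p))
                                                           (≤-trans (YW≤ac cone p) ac≤rac) ⟩
      r * (a * c) + r * (a * c) + r * (a * c)  ≡⟨ solve (r ∷ a ∷ c ∷ []) ⟩
      3 * r * (a * c)                          ∎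
      where
      open ≤-Reasoning
      ac≤rac : a * c ≤ r * (a * c)
      ac≤rac = m≤n*m (a * c) r {{>-nonZero 1≤r}}
      expand : ∀ s x y w → suc (s * (x * x) + y) * w ≡ w + s * (x * x) * w + y * w
      expand = solve-∀

  Outer : (ℕ → ℕ → Set) → Pred Triple 0ℓ
  Outer P (a , _ , c) = P a c

  Charted : ℕ → ℕ → (ℕ → ℕ → Set) → Pred Triple 0ℓ
  Charted r M P = Box r M ∩ Outer P

  module _ {r W P} (chart : Chart r W P) where
    open Chart chart

    chart-count : ∀ {M} .{{_ : NonZero W}} → W ·# Charted r M P ≤ r * (3 * r * M)
    chart-count {M} = ·#-by-key fibred-key fibred-key-injective bound
      where
      fibred-key : ∀ {t} → Charted r M P t → ℕ
      fibred-key {a , b , c} (_ , p) = r * key p + pred b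

      digit< : ∀ {a b c} (t : Charted r M P (a , b , c)) → fibred-key t < r * suc (key (proj₂ t))
      digit< (box , p) = digit-key< r (key p) (InBox.1≤b box) (InBox.b≤r box)

      fibred-key-injective : ∀ {t t'} (x : Charted r M P t) (y : Charted r M P t') →
                             fibred-key x ≡ fibred-key y → t ≡ t'
      fibred-key-injective {a , b , c} {a' , b' , c'} x@(box , p) y@(box' , p') eq
        with offset-injective (r *_) (*-monoʳ-≤ r) (digit< x) (digit< y) eq
      ... | key≡ , pred-b≡
        with square-key-injective 1≤s (Y≤sX (InBox.cone box) p) (Y≤sX (InBox.cone box') p') key≡
      ... | X≡ , Y≡ with injective p p' X≡ Y≡
      ... | refl , refl = cong (λ b → a , b , c)
        (pred-injective {{>-nonZero (InBox.1≤b box)}} {{>-nonZero (InBox.1≤b box')}} pred-b≡)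

      bound : ∀ {t} (x : Charted r M P t) → suc (fibred-key x) * W ≤ r * (3 * r * M)
      bound {a , b , c} x@(box , p) = begin
        suc (fibred-key x) * W    ≤⟨ *-monoˡ-≤ W (digit< x) ⟩
        r * suc (key p) * W       ≡⟨ *-assoc r (suc (key p)) W ⟩
        r * (suc (key p) * W)     ≤⟨ *-monoʳ-≤ r (suc-key*W≤3rac 1≤r cone p) ⟩
        r * (3 * r * (a * c))     ≤⟨ *-monoʳ-≤ r (*-monoʳ-≤ (3 * r) ac≤M) ⟩
        r * (3 * r * M)           ∎
        where
        open ≤-Reasoning
        open InBox box
        1≤r = ≤-trans 1≤b b≤r

  1≤q*d⇒d≤q*d : ∀ q {d} → 1 ≤ q * d → d ≤ q * d
  1≤q*d⇒d≤q*d (suc q) {d} _ = m≤m+n d (q * d)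

  trivial-chart : ∀ {r} → 1 ≤ r → Chart r 1 (λ _ _ → ⊤)
  trivial-chart {r} 1≤r = record
    { s = r ; 1≤s = 1≤r
    ; X = λ {a} {c} _ → c
    ; Y = λ {a} {c} _ → a
    ; injective = λ _ _ c≡c' a≡a' → a≡a' , c≡c'
    ; Y≤sX = λ cone _ → Cone.a≤rc cone
    ; sX²W≤rac = λ {a} {c} cone _ →
        ≤-trans (≤-reflexive (*-identityʳ (r * (c * c)))) (*-monoʳ-≤ r (*-monoˡ-≤ c (Cone.c≤a cone)))
    ; YW≤ac = λ {a} cone _ → *-monoʳ-≤ a (Cone.1≤c cone)
    ; W≤ac = λ cone _ → *-mono-≤ (Cone.1≤a cone) (Cone.1≤c cone)
    }

  module _ {r d : ℕ} .{{_ : NonZero d}} where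

    common-divisor-chart : 1 ≤ r → Chart r (d * d) (λ a c → d ∣ a × d ∣ c)
    common-divisor-chart 1≤r = record
      { s = r ; 1≤s = 1≤r
      ; X = λ (_ , d∣c) → quotient d∣c
      ; Y = λ (d∣a , _) → quotient d∣a
      ; injective = λ { (divides-refl _ , divides-refl _) (divides-refl _ , divides-refl _) refl refl →
                          refl , refl }
      ; Y≤sX = Y≤sX
      ; sX²W≤rac = sX²W≤rac
      ; YW≤ac = YW≤ac
      ; W≤ac = W≤ac
      }
      where
      open ≤-Reasoning
      Y≤sX : ∀ {a c} → Cone r a c → ((d∣a , d∣c) : d ∣ a × d ∣ c) →
             quotient d∣a ≤ r * quotient d∣c
      Y≤sX cone (divides-refl α , divides-refl γ) = *-cancelʳ-≤ α (r * γ) d (begin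
        α * d                       ≤⟨ Cone.a≤rc cone ⟩
        r * (γ * d)                 ≡⟨ *-assoc r γ d ⟨
        r * γ * d                   ∎)
      sX²W≤rac : ∀ {a c} → Cone r a c → ((d∣a , d∣c) : d ∣ a × d ∣ c) →
                 r * (quotient d∣c * quotient d∣c) * (d * d) ≤ r * (a * c)
      sX²W≤rac cone (divides-refl α , divides-refl γ) = begin
        r * (γ * γ) * (d * d)       ≡⟨ solve (r ∷ γ ∷ d ∷ []) ⟩
        r * (γ * d * (γ * d))       ≤⟨ *-monoʳ-≤ r (*-monoˡ-≤ (γ * d) (Cone.c≤a cone)) ⟩
        r * (α * d * (γ * d))       ∎
      YW≤ac : ∀ {a c} → Cone r a c → ((d∣a , d∣c) : d ∣ a × d ∣ c) →
              quotient d∣a * (d * d) ≤ a * c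
      YW≤ac cone (divides-refl α , divides-refl γ) = begin
        α * (d * d)                 ≡⟨ *-assoc α d d ⟨
        α * d * d                   ≤⟨ *-monoʳ-≤ (α * d) (1≤q*d⇒d≤q*d γ (Cone.1≤c cone)) ⟩
        α * d * (γ * d)             ∎
      W≤ac : ∀ {a c} → Cone r a c → d ∣ a × d ∣ c → d * d ≤ a * c
      W≤ac cone (divides-refl α , divides-refl γ) =
        *-mono-≤ (1≤q*d⇒d≤q*d α (Cone.1≤a cone)) (1≤q*d⇒d≤q*d γ (Cone.1≤c cone))

    divisor-of-a-chart : Chart r d (λ a c → d ∣ a)
    divisor-of-a-chart = record
      { s = d ; 1≤s = >-nonZero⁻¹ d
      ; X = quotient
      ; Y = λ {a} {c} _ → c
      ; injective = λ { (divides-refl _) (divides-refl _) refl refl → refl , refl }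
      ; Y≤sX = λ { cone (divides-refl α) → ≤-trans (Cone.c≤a cone) (≤-reflexive (*-comm α d)) }
      ; sX²W≤rac = sX²W≤rac
      ; YW≤ac = λ { {c = c} cone (divides-refl α) →
          ≤-trans (≤-reflexive (*-comm c d)) (*-monoˡ-≤ c (1≤q*d⇒d≤q*d α (Cone.1≤a cone))) }
      ; W≤ac = λ { cone (divides-refl α) →
          ≤-trans (1≤q*d⇒d≤q*d α (Cone.1≤a cone)) (m≤m*n _ _ {{>-nonZero (Cone.1≤c cone)}}) }
      }
      where
      open ≤-Reasoning
      sX²W≤rac : ∀ {a c} → Cone r a c → (d∣a : d ∣ a) →
                 d * (quotient d∣a * quotient d∣a) * d ≤ r * (a * c)
      sX²W≤rac {c = c} cone (divides-refl α) = begin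
        d * (α * α) * d             ≡⟨ solve (d ∷ α ∷ []) ⟩
        α * d * (α * d)             ≤⟨ *-monoʳ-≤ (α * d) (Cone.a≤rc cone) ⟩
        α * d * (r * c)             ≡⟨ solve (α ∷ d ∷ r ∷ c ∷ []) ⟩
        r * (α * d * c)             ∎

    divisor-of-c-chart : 1 ≤ r → Chart r d (λ a c → d ∣ c)
    divisor-of-c-chart 1≤r = record
      { s = r * d ; 1≤s = *-mono-≤ 1≤r (>-nonZero⁻¹ d)
      ; X = quotient
      ; Y = λ {a} {c} _ → a
      ; injective = λ { (divides-refl _) (divides-refl _) refl refl → refl , refl }
      ; Y≤sX = λ { cone (divides-refl γ) →
          ≤-trans (Cone.a≤rc cone) (≤-reflexive (trans (cong (r *_) (*-comm γ d)) (sym (*-assoc r d γ)))) }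
      ; sX²W≤rac = sX²W≤rac
      ; YW≤ac = λ { {a = a} cone (divides-refl γ) → *-monoʳ-≤ a (1≤q*d⇒d≤q*d γ (Cone.1≤c cone)) }
      ; W≤ac = λ { cone (divides-refl γ) →
          ≤-trans (1≤q*d⇒d≤q*d γ (Cone.1≤c cone)) (m≤n*m _ _ {{>-nonZero (Cone.1≤a cone)}}) }
      }
      where
      open ≤-Reasoning
      sX²W≤rac : ∀ {a c} → Cone r a c → (d∣c : d ∣ c) →
                 r * d * (quotient d∣c * quotient d∣c) * d ≤ r * (a * c)
      sX²W≤rac {a} cone (divides-refl γ) = begin
        r * d * (γ * γ) * d         ≡⟨ solve (r ∷ d ∷ γ ∷ []) ⟩
        r * (γ * d * (γ * d))       ≤⟨ *-monoʳ-≤ r (*-monoˡ-≤ (γ * d) (Cone.c≤a cone)) ⟩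
        r * (a * (γ * d))           ∎


module NonCarefree where

  open import Defs using (Carefree)
  open import Data.Nat using (ℕ; _+_; _*_; _≤_; _<_; _≤?_; NonZero; >-nonZero)
  open import Data.Nat.Properties
  open import Data.Nat.Divisibility
    using (_∣_; _∣?_; divides-refl; ∣-trans; m∣m*n; *-cancelˡ-∣; *-pres-∣; ∣-refl; ∣⇒≤)
  open import Data.Nat.Primality using (Prime; euclidsLemma; prime⇒nonZero)
  open import Data.Nat.Tactic.RingSolver using (solve)
  open import Data.List using ([]; _∷_)
  open import Data.Product using (_×_; _,_; proj₁)
  open import Data.Sum using (_⊎_; inj₁; inj₂)
  open import Data.Empty using (⊥-elim)
  open import Data.Unit using (tt)
  open import Level using (0ℓ)
  open import Relation.Nullary using (¬_; yes; no; _×-dec_)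
  open import Relation.Unary using (Pred; ∁; _∩_)
  open import Relation.Binary.PropositionalEquality
  open Counting
  open Charts

  module _ {p} (p-prime : Prime p) where

    p²∣m*n⇒p²∣m : ∀ {m n} → ¬ p ∣ n → p * p ∣ m * n → p * p ∣ m
    p²∣m*n⇒p²∣m {m} {n} p∤n p²∣mn with euclidsLemma m n p-prime (∣-trans (m∣m*n p) p²∣mn)
    ... | inj₂ p∣n = ⊥-elim (p∤n p∣n)
    ... | inj₁ (divides-refl q)
      with euclidsLemma q n p-prime (*-cancelˡ-∣ p {{prime⇒nonZero p-prime}}
             (subst (p * p ∣_) (trans (cong (_* n) (*-comm q p)) (*-assoc p q n)) p²∣mn))
    ...   | inj₁ p∣q = *-pres-∣ p∣q (∣-refl {p})
    ...   | inj₂ p∣n = ⊥-elim (p∤n p∣n)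

    p²∣m*n-cases : ∀ m n → p * p ∣ m * n → (p ∣ m × p ∣ n) ⊎ p * p ∣ m ⊎ p * p ∣ n
    p²∣m*n-cases m n p²∣mn with p ∣? m | p ∣? n
    ... | yes p∣m | yes p∣n = inj₁ (p∣m , p∣n)
    ... | _       | no p∤n  = inj₂ (inj₁ (p²∣m*n⇒p²∣m p∤n p²∣mn))
    ... | no p∤m  | yes _   = inj₂ (inj₂ (p²∣m*n⇒p²∣m p∤m (subst (p * p ∣_) (*-comm m n) p²∣mn)))

    ¬carefree-cases : ∀ {a b c} → ¬ p ∣ b → ¬ Carefree p a b c → (p ∣ a × p ∣ c) ⊎ p * p ∣ a ⊎ p * p ∣ c
    ¬carefree-cases {a} {b} {c} p∤b ¬carefree with p * p ∣? a * b | p * p ∣? b * c | p * p ∣? c * a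
    ... | yes p²∣ab | _         | _         = inj₂ (inj₁ (p²∣m*n⇒p²∣m p∤b p²∣ab))
    ... | _         | yes p²∣bc | _         =
      inj₂ (inj₂ (p²∣m*n⇒p²∣m p∤b (subst (p * p ∣_) (*-comm b c) p²∣bc)))
    ... | _         | _         | yes p²∣ca = p²∣m*n-cases a c (subst (p * p ∣_) (*-comm c a) p²∣ca)
    ... | no p²∤ab  | no p²∤bc  | no p²∤ca  = ⊥-elim (¬carefree (p²∤ab , p²∤bc , p²∤ca))

  NotCarefree : ℕ → Pred Triple 0ℓ
  NotCarefree ℓ (a , b , c) = ¬ Carefree ℓ a b c

  count-constant : ℕ → ℕ
  count-constant r = 3 * r * r * (r * r + 3)

  module _ {ℓ r M : ℕ} (ℓ-prime : Prime ℓ) (1≤r : 1 ≤ r) where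

    private instance
      ℓ≢0 : NonZero ℓ
      ℓ≢0 = prime⇒nonZero ℓ-prime
      ℓ²≢0 : NonZero (ℓ * ℓ)
      ℓ²≢0 = m*n≢0 ℓ ℓ {{ℓ≢0}} {{ℓ≢0}}

    chart-bound : ℕ
    chart-bound = r * (3 * r * M)

    small-prime-count : ℓ ≤ r → (ℓ * ℓ) ·# Box r M ≤ r * r * chart-bound
    small-prime-count ℓ≤r =
      ·#-weaken (r * r) (≤-trans (*-mono-≤ ℓ≤r ℓ≤r) (≤-reflexive (sym (*-identityʳ (r * r)))))
        (·#-⊆ (λ box → box , tt) (chart-count (trivial-chart 1≤r)))

    large-prime-count : r < ℓ →
      (ℓ * ℓ) ·# (Box r M ∩ NotCarefree ℓ) ≤ chart-bound + (chart-bound + chart-bound)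
    large-prime-count r<ℓ =
      ·#-split {Q = Outer (λ a c → ℓ ∣ a × ℓ ∣ c)} (λ (a , _ , c) → ℓ ∣? a ×-dec ℓ ∣? c)
        (·#-⊆ (λ ((box , _) , both) → box , both) (chart-count (common-divisor-chart 1≤r)))
        (·#-split {Q = Outer (λ a c → ℓ * ℓ ∣ a)} (λ (a , _ , c) → ℓ * ℓ ∣? a)
          (·#-⊆ (λ (((box , _) , _) , ℓ²∣a) → box , ℓ²∣a) (chart-count divisor-of-a-chart))
          (·#-⊆ ℓ²∣c-otherwise (chart-count (divisor-of-c-chart 1≤r))))
      where
      ℓ²∣c-otherwise : ∀ {t} →
        (((Box r M ∩ NotCarefree ℓ) ∩ ∁ (Outer (λ a c → ℓ ∣ a × ℓ ∣ c))) ∩ ∁ (Outer (λ a c → ℓ * ℓ ∣ a))) t →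
        Charted r M (λ a c → ℓ * ℓ ∣ c) t
      ℓ²∣c-otherwise {a , b , c} (((box , ¬carefree) , ¬both) , ℓ²∤a)
        with ¬carefree-cases ℓ-prime ℓ∤b ¬carefree
        where
        open InBox box
        ℓ∤b : ¬ ℓ ∣ b
        ℓ∤b ℓ∣b = <⇒≱ r<ℓ (≤-trans (∣⇒≤ {{>-nonZero 1≤b}} ℓ∣b) b≤r)
      ... | inj₁ both = ⊥-elim (¬both both)
      ... | inj₂ (inj₁ ℓ²∣a) = ⊥-elim (ℓ²∤a ℓ²∣a)
      ... | inj₂ (inj₂ ℓ²∣c) = box , ℓ²∣c

    ¬carefree-count : (ℓ * ℓ) ·# (Box r M ∩ NotCarefree ℓ) ≤ count-constant r * M
    ¬carefree-count with ℓ ≤? r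
    ... | yes ℓ≤r = ·#-≤ (begin
        r * r * (r * (3 * r * M))    ≡⟨ solve (r ∷ M ∷ []) ⟩
        3 * r * r * (r * r) * M      ≤⟨ *-monoˡ-≤ M (*-monoʳ-≤ (3 * r * r) (m≤m+n (r * r) 3)) ⟩
        count-constant r * M           ∎)
      (·#-⊆ proj₁ (small-prime-count ℓ≤r))
      where open ≤-Reasoning
    ... | no ℓ≰r = ·#-≤ (begin
        r * (3 * r * M) + (r * (3 * r * M) + r * (3 * r * M))  ≡⟨ solve (r ∷ M ∷ []) ⟩
        3 * r * r * 3 * M    ≤⟨ *-monoˡ-≤ M (*-monoʳ-≤ (3 * r * r) (m≤n+m 3 (r * r))) ⟩
        count-constant r * M   ∎)
      (large-prime-count (≰⇒> ℓ≰r))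
      where open ≤-Reasoning


module Rationals where

  open import Defs using (ι)
  open import Data.Nat as ℕ using (ℕ; suc; z≤n; s≤s)
  import Data.Nat.Properties as ℕ
  open import Data.Nat.Coprimality as Coprime using (Coprime)
  open import Data.Nat.DivMod using (_/_; m/n*n≤m; m*n/n≡m; /-monoˡ-≤)
  open import Data.Integer as ℤ using (+_; -[1+_]; +≤+; -≤+; ∣_∣)
  import Data.Integer.Properties as ℤ
  open import Data.Rational as ℚ using (ℚ; mkℚ; 0ℚ; 1ℚ; _*_; _+_; _<_; _≤_; ↥_; *≤*)
  open import Data.Rational.Properties
  open import Data.Rational.Solver using (module +-*-Solver)
  open import Algebra.Bundles using (CommutativeMonoid)
  open import Algebra.Properties.CommutativeSemigroup
    (CommutativeMonoid.commutativeSemigroup *-1-commutativeMonoid) using (x∙yz≈y∙xz)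
  open import Data.Product using (Σ; _×_; _,_)
  open import Function.Bundles using (_⇔_; mk⇔; Equivalence)
  open import Relation.Nullary using (yes; no; contradiction)
  open import Relation.Binary.PropositionalEquality

  ι≡mkℚ : ∀ n → ι n ≡ mkℚ (+ n) 0 (Coprime.sym (Coprime.1-coprimeTo n))
  ι≡mkℚ n = normalize-coprime _

  ι≤mkℚ⇔ : ∀ {m n d} .{c : Coprime n (suc d)} → ι m ≤ mkℚ (+ n) d c ⇔ m ℕ.* suc d ℕ.≤ n
  ι≤mkℚ⇔ {m} {n} {d} rewrite ι≡mkℚ m = mk⇔
    (λ { (*≤* le) → ℤ.drop‿+≤+ (subst₂ ℤ._≤_ (sym (ℤ.pos-* m (suc d))) (ℤ.*-identityʳ (+ n)) le) })
    (λ le → *≤* (subst₂ ℤ._≤_ (ℤ.pos-* m (suc d)) (sym (ℤ.*-identityʳ (+ n))) (+≤+ le)))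

  ι-mono-≤ : ∀ {m n} → m ℕ.≤ n → ι m ≤ ι n
  ι-mono-≤ {m} {n} m≤n rewrite ι≡mkℚ n =
    Equivalence.from (ι≤mkℚ⇔ {m}) (subst (ℕ._≤ n) (sym (ℕ.*-identityʳ m)) m≤n)

  ι-cancel-≤ : ∀ {m n} → ι m ≤ ι n → m ℕ.≤ n
  ι-cancel-≤ {m} {n} ιm≤ιn rewrite ι≡mkℚ n =
    subst (ℕ._≤ n) (ℕ.*-identityʳ m) (Equivalence.to (ι≤mkℚ⇔ {m}) ιm≤ιn)

  ι-* : ∀ m n → ι (m ℕ.* n) ≡ ι m * ι n
  ι-* m n rewrite ι≡mkℚ m | ι≡mkℚ n = cong (ℚ._/ 1) (ℤ.pos-* m n)

  ι-nonNeg : ∀ n → 0ℚ ≤ ι n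
  ι-nonNeg n = ι-mono-≤ {0} {n} z≤n

  ≤ι∣↥∣ : ∀ R → R ≤ ι ∣ ↥ R ∣
  ≤ι∣↥∣ (mkℚ (+ k) d _) rewrite ι≡mkℚ k =
    *≤* (subst₂ ℤ._≤_ (ℤ.pos-* k 1) (ℤ.pos-* k (suc d)) (+≤+ (ℕ.*-monoʳ-≤ k (s≤s z≤n))))
  ≤ι∣↥∣ (mkℚ -[1+ k ] d _) rewrite ι≡mkℚ (suc k) = *≤* -≤+

  ι-floor : ∀ N → 0ℚ ≤ N → Σ ℕ λ M → ι M ≤ N × (∀ {m} → ι m ≤ N → m ℕ.≤ M)
  ι-floor (mkℚ (+ n) d _) _ =
    n / suc d , Equivalence.from (ι≤mkℚ⇔ {n / suc d}) (m/n*n≤m n (suc d)) , λ {m} ιm≤N →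
      subst (ℕ._≤ n / suc d) (m*n/n≡m m (suc d)) (/-monoˡ-≤ (suc d) (Equivalence.to (ι≤mkℚ⇔ {m}) ιm≤N))
  ι-floor (mkℚ -[1+ _ ] _ _) (*≤* ())

  cube-mono-≤ : ∀ {x y} → 0ℚ ≤ x → x ≤ y → x * x * x ≤ y * y * y
  cube-mono-≤ {x} {y} 0≤x x≤y = begin
    x * x * x   ≤⟨ *-monoʳ-≤-nonNeg x (*-monoʳ-≤-nonNeg x x≤y) ⟩
    y * x * x   ≤⟨ *-monoʳ-≤-nonNeg x (*-monoˡ-≤-nonNeg y x≤y) ⟩
    y * y * x   ≤⟨ *-monoˡ-≤-nonNeg (y * y) {{nonNeg*nonNeg⇒nonNeg y y}} x≤y ⟩
    y * y * y   ∎
    where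
    open ≤-Reasoning
    instance
      x≥0 = ℚ.nonNegative 0≤x
      y≥0 = ℚ.nonNegative (≤-trans 0≤x x≤y)

  ι[x³k]<N³⇒ιx≤N : ∀ {x k N} → 1 ℕ.≤ k → 0ℚ ≤ N → ι (x ℕ.* x ℕ.* x ℕ.* k) < N * N * N → ι x ≤ N
  ι[x³k]<N³⇒ιx≤N {x} {k} {N} 1≤k 0≤N x³k<N³ with ι x ≤? N
  ... | yes ιx≤N = ιx≤N
  ... | no ιx≰N = contradiction (<-≤-trans x³k<N³ (begin
    N * N * N                  ≤⟨ cube-mono-≤ 0≤N (<⇒≤ (≰⇒> ιx≰N)) ⟩
    ι x * ι x * ι x            ≡⟨ cong (_* ι x) (ι-* x x) ⟨
    ι (x ℕ.* x) * ι x          ≡⟨ ι-* (x ℕ.* x) x ⟨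
    ι (x ℕ.* x ℕ.* x)          ≤⟨ ι-mono-≤ {x ℕ.* x ℕ.* x} (ℕ.m≤m*n _ k {{ℕ.>-nonZero 1≤k}}) ⟩
    ι (x ℕ.* x ℕ.* x ℕ.* k)    ∎)) (<-irrefl refl)
    where open ≤-Reasoning

  1≤u³L²⇒1≤uL : ∀ {u L} → 0ℚ ≤ u → 1ℚ ≤ L → 1ℚ ≤ u * u * u * (L * L) → 1ℚ ≤ u * L
  1≤u³L²⇒1≤uL {u} {L} 0≤u 1≤L 1≤u³L² with 1ℚ ≤? u * L
  ... | yes 1≤uL = 1≤uL
  ... | no 1≰uL = contradiction (≤-<-trans 1≤u³L² (begin-strict
    u * u * u * (L * L)   ≡⟨ rearrange u L ⟩
    w * w * u             ≤⟨ *-monoˡ-≤-nonNeg (w * w) {{nonNeg*nonNeg⇒nonNeg w w}} (<⇒≤ (≤-<-trans u≤w w<1)) ⟩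
    w * w * 1ℚ            ≡⟨ *-identityʳ (w * w) ⟩
    w * w                 ≤⟨ *-monoˡ-≤-nonNeg w (<⇒≤ w<1) ⟩
    w * 1ℚ                ≡⟨ *-identityʳ w ⟩
    w                     <⟨ w<1 ⟩
    1ℚ                    ∎)) (<-irrefl refl)
    where
    open ≤-Reasoning
    w = u * L
    w<1 : w < 1ℚ
    w<1 = ≰⇒> 1≰uL
    instance u≥0 = ℚ.nonNegative 0≤u
    u≤w : u ≤ w
    u≤w = ≤-trans (≤-reflexive (sym (*-identityʳ u))) (*-monoˡ-≤-nonNeg u 1≤L)
    instance w≥0 = ℚ.nonNegative (≤-trans 0≤u u≤w)
    rearrange : ∀ u L → u * u * u * (L * L) ≡ (u * L) * (u * L) * u
    rearrange = solve 2 (λ u L → u :* u :* u :* (L :* L) := (u :* L) :* (u :* L) :* u) refl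
      where open +-*-Solver

  1≤p⇒0≤p : ∀ {p} → 1ℚ ≤ p → 0ℚ ≤ p
  1≤p⇒0≤p = ≤-trans (ι-nonNeg 1)

  p≤p+q : ∀ p {q} → 0ℚ ≤ q → p ≤ p + q
  p≤p+q p 0≤q = ≤-trans (≤-reflexive (sym (+-identityʳ p))) (+-monoʳ-≤ p 0≤q)

  x*L≤y⇒x≤u*y : ∀ {x y u L} → 0ℚ ≤ x → 1ℚ ≤ u * L → x * L ≤ y → 0ℚ ≤ u → x ≤ u * y
  x*L≤y⇒x≤u*y {x} {y} {u} {L} 0≤x 1≤uL xL≤y 0≤u = begin
    x               ≡⟨ *-identityʳ x ⟨
    x * 1ℚ          ≤⟨ *-monoˡ-≤-nonNeg x {{ℚ.nonNegative 0≤x}} 1≤uL ⟩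
    x * (u * L)     ≡⟨ x∙yz≈y∙xz x u L ⟩
    u * (x * L)     ≤⟨ *-monoˡ-≤-nonNeg u {{ℚ.nonNegative 0≤u}} xL≤y ⟩
    u * y           ∎
    where open ≤-Reasoning


open import Defs
open import Data.Nat as ℕ using (ℕ)
open import Data.Nat.Primality using (Prime)
open import Data.Rational using (ℚ; 0ℚ; 1ℚ; _*_; _+_; _<_; _≤_)
open import Data.Product using (_×_; Σ)
open import Data.List using (List; length)
open import Data.List.Relation.Unary.All using (All)
open import Data.List.Relation.Unary.Unique.Propositional using (Unique)

open import Data.Nat using (suc; z≤n; s≤s; >-nonZero⁻¹)
open import Data.Nat.Primality using (prime⇒nonZero)
import Data.Nat.Properties as ℕ
open import Data.Integer using (∣_∣)
open import Data.Rational as ℚ using (↥_)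
open import Data.Rational.Properties
import Data.List.Relation.Unary.All as All
open import Data.Product using (_,_)
open import Relation.Binary.PropositionalEquality
open Charts using (Box; Cone; InBox)
open NonCarefree using (count-constant; ¬carefree-count)
open Rationals

InRegion⇒Box : ∀ {N R₁ R₂ r M} → 0ℚ ≤ N → R₁ ≤ ι r → R₂ ≤ ι r → (∀ {m} → ι m ≤ N → m ℕ.≤ M) →
               ∀ {t} → InRegion N R₁ R₂ t → Box r M t
InRegion⇒Box {R₁ = R₁} {r = r} 0≤N R₁≤r R₂≤r ≤M {a , b , c}
  (_ , 1≤b , 1≤c , x³b²<N³ , c≤a , a≤R₁c , b≤R₂) = record
  { cone = record { 1≤c = 1≤c ; c≤a = c≤a ; a≤rc = ι-cancel-≤ {a} (begin
      ι a               ≤⟨ a≤R₁c ⟩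
      R₁ * ι c          ≤⟨ *-monoʳ-≤-nonNeg (ι c) {{ℚ.nonNegative (ι-nonNeg c)}} R₁≤r ⟩
      ι r * ι c         ≡⟨ ι-* r c ⟨
      ι (r ℕ.* c)       ∎) }
  ; 1≤b = 1≤b
  ; b≤r = ι-cancel-≤ {b} (≤-trans b≤R₂ R₂≤r)
  ; ac≤M = ≤M (ι[x³k]<N³⇒ιx≤N {a ℕ.* c} (ℕ.*-mono-≤ 1≤b 1≤b) 0≤N x³b²<N³)
  }
  where open ≤-Reasoning

InC'-count : ∀ {ℓ N R₁ R₂ r} → Prime ℓ → 0ℚ ≤ N → R₁ ≤ ι r → R₂ ≤ ι r → 1 ℕ.≤ r →
             ∀ {xs} → Unique xs → All (InC' ℓ N R₁ R₂) xs →
             ι (length xs) * ι (ℓ ℕ.* ℓ) ≤ ι (count-constant r) * N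
InC'-count {ℓ} {N} {r = r} ℓ-prime 0≤N R₁≤r R₂≤r 1≤r {xs} unique inC' with ι-floor N 0≤N
... | M , M≤N , ≤M = begin
  ι (length xs) * ι (ℓ ℕ.* ℓ)     ≡⟨ ι-* (length xs) (ℓ ℕ.* ℓ) ⟨
  ι (length xs ℕ.* (ℓ ℕ.* ℓ))     ≤⟨ ι-mono-≤ {length xs ℕ.* (ℓ ℕ.* ℓ)} count ⟩
  ι (count-constant r ℕ.* M)        ≡⟨ ι-* (count-constant r) M ⟩
  ι (count-constant r) * ι M        ≤⟨ *-monoˡ-≤-nonNeg (ι (count-constant r))
                                       {{ℚ.nonNegative (ι-nonNeg (count-constant r))}} M≤N ⟩
  ι (count-constant r) * N          ∎
  where
  open ≤-Reasoning
  count : length xs ℕ.* (ℓ ℕ.* ℓ) ℕ.≤ count-constant r ℕ.* M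
  count = ¬carefree-count ℓ-prime 1≤r unique
    (All.map (λ (inR , ¬carefree) → InRegion⇒Box 0≤N R₁≤r R₂≤r ≤M inR , ¬carefree) inC')

1≤u³ℓ⁴⇒1≤uℓ² : ∀ {ℓ u} → 1 ℕ.≤ ℓ → 0ℚ ≤ u → 1ℚ ≤ u * u * u * ι (ℓ ℕ.* ℓ ℕ.* ℓ ℕ.* ℓ) → 1ℚ ≤ u * ι (ℓ ℕ.* ℓ)
1≤u³ℓ⁴⇒1≤uℓ² {ℓ} {u} 1≤ℓ 0≤u 1≤u³ℓ⁴ =
  1≤u³L²⇒1≤uL 0≤u (ι-mono-≤ {1} {ℓ ℕ.* ℓ} (ℕ.*-mono-≤ 1≤ℓ 1≤ℓ))
    (subst (λ L → 1ℚ ≤ u * u * u * L) ℓ⁴≡ℓ²ℓ² 1≤u³ℓ⁴)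
  where
  ℓ⁴≡ℓ²ℓ² : ι (ℓ ℕ.* ℓ ℕ.* ℓ ℕ.* ℓ) ≡ ι (ℓ ℕ.* ℓ) * ι (ℓ ℕ.* ℓ)
  ℓ⁴≡ℓ²ℓ² = trans (cong ι (ℕ.*-assoc (ℓ ℕ.* ℓ) ℓ ℓ)) (ι-* (ℓ ℕ.* ℓ) (ℓ ℕ.* ℓ))

mainTheorem7 : (R₁ R₂ : ℚ) → 1ℚ ≤ R₁ → 1ℚ ≤ R₂ →
    Σ ℚ λ K → 0ℚ < K ×
      ((ℓ : ℕ) → Prime ℓ → (N : ℚ) → 1ℚ ≤ N →
        (u v : ℚ) → 0ℚ ≤ u → 1ℚ ≤ u * u * u * ι (ℓ ℕ.* ℓ ℕ.* ℓ ℕ.* ℓ)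
          → 0ℚ ≤ v → 1ℚ ≤ v * v * N →
        (xs : List (ℕ × ℕ × ℕ)) → Unique xs → All (InC' ℓ N R₁ R₂) xs →
        ι (length xs) ≤ K * (u + v) * N)
mainTheorem7 R₁ R₂ _ _ = K , 0<K , λ ℓ ℓ-prime N 1≤N u v 0≤u 1≤u³ℓ⁴ 0≤v _ xs unique inC' →
  let 0≤N   = 1≤p⇒0≤p 1≤N
      1≤uℓ² = 1≤u³ℓ⁴⇒1≤uℓ² (>-nonZero⁻¹ ℓ {{prime⇒nonZero ℓ-prime}}) 0≤u 1≤u³ℓ⁴
      count = InC'-count {r = r} ℓ-prime 0≤N R₁≤r R₂≤r (s≤s z≤n) unique inC'
  in begin
    ι (length xs)    ≤⟨ x*L≤y⇒x≤u*y (ι-nonNeg (length xs)) 1≤uℓ² count 0≤u ⟩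
    u * (K * N)      ≡⟨ *-assoc u K N ⟨
    u * K * N        ≡⟨ cong (_* N) (*-comm u K) ⟩
    K * u * N        ≤⟨ *-monoʳ-≤-nonNeg N {{ℚ.nonNegative 0≤N}}
                          (*-monoˡ-≤-nonNeg K {{ℚ.nonNegative (<⇒≤ 0<K)}} (p≤p+q u 0≤v)) ⟩
    K * (u + v) * N  ∎
  where
  open ≤-Reasoning
  r = suc (∣ ↥ R₁ ∣ ℕ.+ ∣ ↥ R₂ ∣)
  K = ι (count-constant r)
  0<K : 0ℚ < K
  -- r is a successor, so count-constant r normalises to a successor as well.
  0<K = <-≤-trans (positive⁻¹ 1ℚ) (ι-mono-≤ {1} {count-constant r} (s≤s z≤n))
  R₁≤r : R₁ ≤ ι r
  R₁≤r = ≤-trans (≤ι∣↥∣ R₁) (ι-mono-≤ {∣ ↥ R₁ ∣} {r} (ℕ.m≤n⇒m≤1+n (ℕ.m≤m+n _ _)))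
  R₂≤r : R₂ ≤ ι r
  R₂≤r = ≤-trans (≤ι∣↥∣ R₂) (ι-mono-≤ {∣ ↥ R₂ ∣} {r} (ℕ.m≤n⇒m≤1+n (ℕ.m≤n+m _ _)))
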